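{- There exist a binary matrix $A$ and two binary column vectors $x,y$ such that $R_{binary}(A|x)=R_{binary}(A|y)=R_{binary}(A)$ but $R_{binary}(A|x,y)>R_{binary}(A)$.
   Context: A binary matrix has entries in $\{0,1\}$. The binary rank $R_{binary}(A)$ of an $n\times m$ binary matrix $A$ is the minimal $k$ such that $A=U\cdot V$ with $U$ an $n\times k$ and $V$ a $k\times m$ binary matrix, using ordinary integer arithmetic. $(A|x_1,\dots,x_t)$ denotes $A$ with columns $x_1,\dots,x_t$ appended. -}

module Defs where

open import Data.Nat using (ℕ; zero; suc; _+_; _*_; _<_)
open import Data.Fin using (Fin; zero; suc)
open import Data.Product using (Σ; _×_)
open import Relation.Nullary using (¬_)
open import Relation.Binary.PropositionalEquality using (_≡_)
open import Data.Sum using (_⊎_)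

-- An n × m matrix with natural-number entries (ordinary integer arithmetic).
Matrix : ℕ → ℕ → Set
Matrix n m = Fin n → Fin m → ℕ

Column : ℕ → Set
Column n = Fin n → ℕ

IsBit : ℕ → Set
IsBit a = (a ≡ 0) ⊎ (a ≡ 1)

IsBinary : ∀ {n m} → Matrix n m → Set
IsBinary {n} {m} A = ∀ (i : Fin n) (j : Fin m) → IsBit (A i j)

IsBinaryColumn : ∀ {n} → Column n → Set
IsBinaryColumn {n} x = ∀ (i : Fin n) → IsBit (x i)

∑ : ∀ k → (Fin k → ℕ) → ℕ
∑ zero f = 0
∑ (suc k) f = f zero + ∑ k (λ i → f (suc i))

_⊗_ : ∀ {n k m} → Matrix n k → Matrix k m → Matrix n m
_⊗_ {k = k} U V i j = ∑ k (λ l → U i l * V l j)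

HasBinaryFactorization : ∀ {n m} → Matrix n m → ℕ → Set
HasBinaryFactorization {n} {m} A k =
  Σ (Matrix n k) λ U → Σ (Matrix k m) λ V →
    IsBinary U × IsBinary V × (∀ i j → (U ⊗ V) i j ≡ A i j)

BinaryRank : ∀ {n m} → Matrix n m → ℕ → Set
BinaryRank A r = HasBinaryFactorization A r × (∀ k → k < r → ¬ HasBinaryFactorization A k)

lastOr : ∀ {m} {B : Set} → (Fin m → B) → B → Fin (suc m) → B
lastOr {zero} f b zero = b
lastOr {suc m} f b zero = f zero
lastOr {suc m} f b (suc j) = lastOr (λ j′ → f (suc j′)) b j

appendCol : ∀ {n m} → Matrix n m → Column n → Matrix n (suc m)
appendCol A x i = lastOr (A i) (x i)

-- Every lower bound comes from a fooling set: a binary factorization A = U·V of inner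
-- size k covers every 1 of A by one of k all-ones combinatorial rectangles, and two
-- cells (i,j), (i′,j′) with A i j′ = 0 or A i′ j = 0 cannot lie in a common rectangle,
-- so a fooling set of size t forces k ≥ t.
--
-- Take A with columns c₁ = (0,0,1,1), c₂ = (0,1,0,1) and the all-ones column c₃, and
-- x = c₃ − c₂, y = c₃ − c₁. Each of (A|x) and (A|y) still has a binary factorization
-- of size 3, obtained by splitting c₃ as x + c₂ resp. y + c₁, while (A|x,y) contains a
-- fooling set of size 4.
module Submission where

open import Defs
open import Data.Nat using (ℕ; _<_; _≤_; zero; suc; _+_; _*_; z≤n; s≤s)
open import Data.Nat.Properties using (≤-trans; <-≤-trans; m≤m+n; m≤n+m; n≮n; _≟_)
open import Data.Fin using (Fin; zero; suc; #_)
open import Data.Fin.Properties using (all?; pigeonhole; <⇒≢) renaming (_≟_ to _≟ᶠ_)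
open import Data.Product using (Σ; _×_; _,_; proj₁; proj₂)
open import Data.Sum using (_⊎_; inj₁; inj₂)
open import Data.Vec using (Vec; []; _∷_; lookup)
open import Data.Empty using (⊥)
open import Relation.Nullary using (¬_; Dec; yes; no)
open import Relation.Nullary.Decidable using (True; toWitness; from-yes; _×-dec_; _⊎-dec_)
open import Relation.Binary.PropositionalEquality using (_≡_; refl; sym; trans; subst)

∑-positive⇒term-positive : ∀ k (f : Fin k → ℕ) → 0 < ∑ k f → Σ (Fin k) λ l → 0 < f l
∑-positive⇒term-positive (suc k) f ∑f>0 with f zero in f₀≡
... | suc _ = zero , subst (0 <_) (sym f₀≡) (s≤s z≤n)
... | zero with ∑-positive⇒term-positive k (λ l → f (suc l)) ∑f>0
...   | l , fl>0 = suc l , fl>0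

term≤∑ : ∀ k (f : Fin k → ℕ) l → f l ≤ ∑ k f
term≤∑ (suc k) f zero    = m≤m+n _ _
term≤∑ (suc k) f (suc l) = ≤-trans (term≤∑ k (λ l′ → f (suc l′)) l) (m≤n+m _ _)

bits-product-positive : ∀ {a b} → IsBit a → IsBit b → 0 < a * b → (a ≡ 1) × (b ≡ 1)
bits-product-positive (inj₁ refl) _           ()
bits-product-positive (inj₂ refl) (inj₁ refl) ()
bits-product-positive (inj₂ refl) (inj₂ refl) _ = refl , refl

product-positive⇒common-one : ∀ {n k m} {U : Matrix n k} {V : Matrix k m} →
  IsBinary U → IsBinary V → ∀ i j → 0 < (U ⊗ V) i j →
  Σ (Fin k) λ l → (U i l ≡ 1) × (V l j ≡ 1)
product-positive⇒common-one {k = k} {U = U} {V = V} binU binV i j UVij>0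
  with ∑-positive⇒term-positive k (λ l → U i l * V l j) UVij>0
... | l , term>0 = l , bits-product-positive (binU i l) (binV l j) term>0

common-one⇒product-positive : ∀ {n k m} (U : Matrix n k) (V : Matrix k m) i j l →
  U i l ≡ 1 → V l j ≡ 1 → 0 < (U ⊗ V) i j
common-one⇒product-positive {k = k} U V i j l Uil≡1 Vlj≡1 =
  <-≤-trans term>0 (term≤∑ k (λ l′ → U i l′ * V l′ j) l)
  where
  term>0 : 0 < U i l * V l j
  term>0 rewrite Uil≡1 | Vlj≡1 = s≤s z≤n

IsFoolingSet : ∀ {n m t} → Matrix n m → (Fin t → Fin n) → (Fin t → Fin m) → Set
IsFoolingSet M rows cols =
  (∀ p → M (rows p) (cols p) ≡ 1) ×
  (∀ p q → (p ≡ q) ⊎ ((M (rows p) (cols q) ≡ 0) ⊎ (M (rows q) (cols p) ≡ 0)))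

foolingSet⇒noFactorization : ∀ {n m t k} {M : Matrix n m} {rows : Fin t → Fin n} {cols : Fin t → Fin m} →
  IsFoolingSet M rows cols → k < t → ¬ HasBinaryFactorization M k
foolingSet⇒noFactorization {t = t} {k} {M} {rows} {cols} (ones , separated) k<t (U , V , binU , binV , UV≡M) =
  absurd
  where
  covering : ∀ p → Σ (Fin k) λ l → (U (rows p) l ≡ 1) × (V l (cols p) ≡ 1)
  covering p = product-positive⇒common-one binU binV (rows p) (cols p)
    (subst (0 <_) (sym (trans (UV≡M (rows p) (cols p)) (ones p))) (s≤s z≤n))

  rectangle : Fin t → Fin k
  rectangle p = proj₁ (covering p)

  sameRectangle⇒positive : ∀ p q → rectangle p ≡ rectangle q → 0 < M (rows p) (cols q)
  sameRectangle⇒positive p q same = subst (0 <_) (UV≡M (rows p) (cols q))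
    (common-one⇒product-positive U V (rows p) (cols q) (rectangle p)
      (proj₁ (proj₂ (covering p)))
      (subst (λ l → V l (cols q) ≡ 1) (sym same) (proj₂ (proj₂ (covering q)))))

  absurd : ⊥
  absurd with pigeonhole k<t rectangle
  ... | p , q , p<q , same with separated p q
  ...   | inj₁ p≡q        = <⇒≢ p<q p≡q
  ...   | inj₂ (inj₁ Mpq≡0) = n≮n 0 (subst (0 <_) Mpq≡0 (sameRectangle⇒positive p q same))
  ...   | inj₂ (inj₂ Mqp≡0) = n≮n 0 (subst (0 <_) Mqp≡0 (sameRectangle⇒positive q p (sym same)))

bit? : ∀ a → Dec (IsBit a)
bit? a = (a ≟ 0) ⊎-dec (a ≟ 1)

binary? : ∀ {n m} (M : Matrix n m) → Dec (IsBinary M)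
binary? M = all? λ i → all? λ j → bit? (M i j)

binaryColumn? : ∀ {n} (x : Column n) → Dec (IsBinaryColumn x)
binaryColumn? x = all? λ i → bit? (x i)

factorizes? : ∀ {n k m} (U : Matrix n k) (V : Matrix k m) (M : Matrix n m) →
  Dec (∀ i j → (U ⊗ V) i j ≡ M i j)
factorizes? U V M = all? λ i → all? λ j → (U ⊗ V) i j ≟ M i j

foolingSet? : ∀ {n m t} (M : Matrix n m) (rows : Fin t → Fin n) (cols : Fin t → Fin m) →
  Dec (IsFoolingSet M rows cols)
foolingSet? M rows cols =
  (all? λ p → M (rows p) (cols p) ≟ 1) ×-dec
  (all? λ p → all? λ q →
    (p ≟ᶠ q) ⊎-dec ((M (rows p) (cols q) ≟ 0) ⊎-dec (M (rows q) (cols p) ≟ 0)))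

binaryRank-certificate : ∀ {n m t} (M : Matrix n m) (U : Matrix n t) (V : Matrix t m)
  (rows : Fin t → Fin n) (cols : Fin t → Fin m) →
  {True (binary? U)} → {True (binary? V)} → {True (factorizes? U V M)} →
  {True (foolingSet? M rows cols)} → BinaryRank M t
binaryRank-certificate M U V rows cols {binU} {binV} {UV≡M} {fooling} =
  (U , V , toWitness binU , toWitness binV , toWitness UV≡M) ,
  λ k k<t → foolingSet⇒noFactorization (toWitness fooling) k<t

fromRows : ∀ {n m} → Vec (Vec ℕ m) n → Matrix n m
fromRows rows i j = lookup (lookup rows i) j

A : Matrix 4 3
A = fromRows ((0 ∷ 0 ∷ 1 ∷ []) ∷ (0 ∷ 1 ∷ 1 ∷ []) ∷ (1 ∷ 0 ∷ 1 ∷ []) ∷ (1 ∷ 1 ∷ 1 ∷ []) ∷ [])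

x : Column 4
x = lookup (1 ∷ 0 ∷ 1 ∷ 0 ∷ [])

y : Column 4
y = lookup (1 ∷ 1 ∷ 0 ∷ 0 ∷ [])

identity : ∀ n → Matrix n n
identity n i j with i ≟ᶠ j
... | yes _ = 1
... | no _  = 0

-- Shared by A, (A|x) and (A|y), which agree on their first three columns.
foolingRows₃ : Fin 3 → Fin 4
foolingRows₃ = lookup (# 0 ∷ # 1 ∷ # 3 ∷ [])

foolingCols₃ : ∀ {m} → Fin 3 → Fin (3 + m)
foolingCols₃ = lookup (# 2 ∷ # 1 ∷ # 0 ∷ [])

rank-A : BinaryRank A 3
rank-A = binaryRank-certificate A A (identity 3) foolingRows₃ foolingCols₃

rank-Ax : BinaryRank (appendCol A x) 3
rank-Ax = binaryRank-certificate (appendCol A x)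
  (fromRows ((0 ∷ 1 ∷ 0 ∷ []) ∷ (0 ∷ 0 ∷ 1 ∷ []) ∷ (1 ∷ 1 ∷ 0 ∷ []) ∷ (1 ∷ 0 ∷ 1 ∷ []) ∷ []))
  (fromRows ((1 ∷ 0 ∷ 0 ∷ 0 ∷ []) ∷ (0 ∷ 0 ∷ 1 ∷ 1 ∷ []) ∷ (0 ∷ 1 ∷ 1 ∷ 0 ∷ []) ∷ []))
  foolingRows₃ foolingCols₃

rank-Ay : BinaryRank (appendCol A y) 3
rank-Ay = binaryRank-certificate (appendCol A y)
  (fromRows ((1 ∷ 0 ∷ 0 ∷ []) ∷ (1 ∷ 1 ∷ 0 ∷ []) ∷ (0 ∷ 0 ∷ 1 ∷ []) ∷ (0 ∷ 1 ∷ 1 ∷ []) ∷ []))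
  (fromRows ((0 ∷ 0 ∷ 1 ∷ 1 ∷ []) ∷ (0 ∷ 1 ∷ 0 ∷ 0 ∷ []) ∷ (1 ∷ 0 ∷ 1 ∷ 0 ∷ []) ∷ []))
  foolingRows₃ foolingCols₃

rank-Axy : BinaryRank (appendCol (appendCol A x) y) 4
rank-Axy = binaryRank-certificate (appendCol (appendCol A x) y)
  (identity 4) (appendCol (appendCol A x) y)
  (lookup (# 0 ∷ # 1 ∷ # 2 ∷ # 3 ∷ [])) (lookup (# 4 ∷ # 1 ∷ # 3 ∷ # 0 ∷ []))

mainTheorem7 : Σ ℕ λ n → Σ ℕ λ m → Σ (Matrix n m) λ A → Σ (Column n) λ x → Σ (Column n) λ y →
    IsBinary A × IsBinaryColumn x × IsBinaryColumn y ×
    Σ ℕ λ r → Σ ℕ λ s →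
    BinaryRank A r ×
    BinaryRank (appendCol A x) r ×
    BinaryRank (appendCol A y) r ×
    BinaryRank (appendCol (appendCol A x) y) s ×
    r < s
mainTheorem7 = 4 , 3 , A , x , y ,
  from-yes (binary? A) , from-yes (binaryColumn? x) , from-yes (binaryColumn? y) ,
  3 , 4 , rank-A , rank-Ax , rank-Ay , rank-Axy , s≤s (s≤s (s≤s (s≤s z≤n)))
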